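{- Let $\mathcal{C}$ be a left sum-generating class and let $\oplus'$ be a regular, associative sum on $\mathcal{C}$. For a linear order $A$ let $A_L$ be the longest initial segment of $A$ belonging to $\mathcal{C}$ and $A_R = A\setminus A_L$. Then the operation $A \oplus B = (A_L \oplus' B_L) + A_R + B_R$ on all linear orders is a regular, associative sum.
   Context: A class $\mathcal{C}$ of linear orders is left sum-generating if: (i) it is closed under isomorphism; (ii) $A + B \in \mathcal{C}$ implies $B \in \mathcal{C}$; (iii) if $\beta$ is an ordinal and $A_\alpha \in \mathcal{C}$ for all $\alpha<\beta$, then $\sum_{\alpha<\beta} A_\alpha \in \mathcal{C}$. (For such $\mathcal{C}$ every linear order has a longest initial segment in $\mathcal{C}$, possibly empty.) A sum assigns to linear orders $A, B$ a linear order $A \oplus B$ that is the disjoint union of two suborders isomorphic to $A$ and $B$ respectively (given by specified embeddings). A sum $\oplus'$ on a class $\mathcal{C}$ is such an operation defined for $A,B\in\mathcal{C}$ with values in $\mathcal{C}$; it is regular if $A\cong A'$, $B\cong B'$ imply $A\oplus' B\cong A'\oplus' B'$, and associative if $A\oplus'(B\oplus' C)\cong(A\oplus' B)\oplus' C$. -}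

module Defs where

open import Data.Bool using (Bool; true; false; T; not)
open import Data.Bool.Properties using (T-irrelevant)
open import Data.Unit using (tt)
open import Data.Empty using (⊥; ⊥-elim)
open import Data.Sum using (_⊎_; inj₁; inj₂)
open import Data.Product using (Σ; Σ-syntax; ∃; _×_; _,_; proj₁; proj₂)
open import Relation.Nullary using (¬_)
open import Relation.Binary.PropositionalEquality
open import Induction.WellFounded using (WellFounded)

record LinOrd : Set₁ where
  field
    Car    : Set
    lt     : Car → Car → Set
    lt-irrefl : ∀ {x} → ¬ lt x x
    lt-trans  : ∀ {x y z} → lt x y → lt y z → lt x z
    lt-total  : ∀ x y → lt x y ⊎ x ≡ y ⊎ lt y x

open LinOrd public

record _≅_ (A B : LinOrd) : Set where
  field
    to        : Car A → Car B
    from      : Car B → Car A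
    from∘to   : ∀ a → from (to a) ≡ a
    to∘from   : ∀ b → to (from b) ≡ b
    to-mono   : ∀ {x y} → lt A x y → lt B (to x) (to y)
    from-mono : ∀ {x y} → lt B x y → lt A (from x) (from y)

IsEmbedding : (A B : LinOrd) → (Car A → Car B) → Set
IsEmbedding A B f = ∀ x y → (lt A x y → lt B (f x) (f y)) × (lt B (f x) (f y) → lt A x y)

data SumLt (A B : LinOrd) : Car A ⊎ Car B → Car A ⊎ Car B → Set where
  ll : ∀ {x y} → lt A x y → SumLt A B (inj₁ x) (inj₁ y)
  lr : ∀ {x y} → SumLt A B (inj₁ x) (inj₂ y)
  rr : ∀ {x y} → lt B x y → SumLt A B (inj₂ x) (inj₂ y)

infixl 6 _+ᴸ_
_+ᴸ_ : LinOrd → LinOrd → LinOrd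
A +ᴸ B = record
  { Car = Car A ⊎ Car B ; lt = SumLt A B ; lt-irrefl = irr ; lt-trans = tr ; lt-total = tot }
  where
  irr : ∀ {x} → ¬ SumLt A B x x
  irr (ll p) = lt-irrefl A p
  irr (rr p) = lt-irrefl B p
  tr : ∀ {x y z} → SumLt A B x y → SumLt A B y z → SumLt A B x z
  tr (ll p) (ll q) = ll (lt-trans A p q)
  tr (ll p) lr = lr
  tr lr (rr q) = lr
  tr (rr p) (rr q) = rr (lt-trans B p q)
  tot : ∀ x y → SumLt A B x y ⊎ x ≡ y ⊎ SumLt A B y x
  tot (inj₁ x) (inj₂ y) = inj₁ lr
  tot (inj₂ x) (inj₁ y) = inj₂ (inj₂ lr)
  tot (inj₁ x) (inj₁ y) with lt-total A x y
  ... | inj₁ p = inj₁ (ll p)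
  ... | inj₂ (inj₁ e) = inj₂ (inj₁ (cong inj₁ e))
  ... | inj₂ (inj₂ p) = inj₂ (inj₂ (ll p))
  tot (inj₂ x) (inj₂ y) with lt-total B x y
  ... | inj₁ p = inj₁ (rr p)
  ... | inj₂ (inj₁ e) = inj₂ (inj₁ (cong inj₂ e))
  ... | inj₂ (inj₂ p) = inj₂ (inj₂ (rr p))

data LexLt (β : LinOrd) (F : Car β → LinOrd) :
     Σ (Car β) (λ α → Car (F α)) → Σ (Car β) (λ α → Car (F α)) → Set where
  fst< : ∀ {α α' x x'} → lt β α α' → LexLt β F (α , x) (α' , x')
  snd< : ∀ {α x x'} → lt (F α) x x' → LexLt β F (α , x) (α , x')

OrdSum : (β : LinOrd) → (Car β → LinOrd) → LinOrd
OrdSum β F = record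
  { Car = Σ (Car β) (λ α → Car (F α)) ; lt = LexLt β F
  ; lt-irrefl = irr ; lt-trans = tr ; lt-total = tot }
  where
  irr : ∀ {x} → ¬ LexLt β F x x
  irr (fst< p) = lt-irrefl β p
  irr {α , x} (snd< p) = lt-irrefl (F α) p
  tr : ∀ {x y z} → LexLt β F x y → LexLt β F y z → LexLt β F x z
  tr (fst< p) (fst< q) = fst< (lt-trans β p q)
  tr (fst< p) (snd< q) = fst< p
  tr (snd< p) (fst< q) = fst< q
  tr {α , _} (snd< p) (snd< q) = snd< (lt-trans (F α) p q)
  tot : ∀ x y → LexLt β F x y ⊎ x ≡ y ⊎ LexLt β F y x
  tot (α , x) (α' , x') with lt-total β α α'
  ... | inj₁ p = inj₁ (fst< p)
  ... | inj₂ (inj₂ p) = inj₂ (inj₂ (fst< p))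
  ... | inj₂ (inj₁ refl) with lt-total (F α) x x'
  ...   | inj₁ p = inj₁ (snd< p)
  ...   | inj₂ (inj₁ refl) = inj₂ (inj₁ refl)
  ...   | inj₂ (inj₂ p) = inj₂ (inj₂ (snd< p))

-- Suborders given by (classically arbitrary) subsets S : Car A → Bool

Sub : (A : LinOrd) → (Car A → Bool) → LinOrd
Sub A S = record
  { Car = Σ (Car A) (λ a → T (S a)) ; lt = λ x y → lt A (proj₁ x) (proj₁ y)
  ; lt-irrefl = lt-irrefl A ; lt-trans = lt-trans A ; lt-total = tot }
  where
  tot : ∀ (x y : Σ (Car A) (λ a → T (S a))) →
        lt A (proj₁ x) (proj₁ y) ⊎ x ≡ y ⊎ lt A (proj₁ y) (proj₁ x)
  tot (a , p) (b , q) with lt-total A a b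
  ... | inj₁ r = inj₁ r
  ... | inj₂ (inj₂ r) = inj₂ (inj₂ r)
  ... | inj₂ (inj₁ refl) = inj₂ (inj₁ (cong (a ,_) (T-irrelevant p q)))

IsInitial : (A : LinOrd) → (Car A → Bool) → Set
IsInitial A S = ∀ {a b} → lt A a b → T (S b) → T (S a)

record LeftSumGenerating (𝒞 : LinOrd → Set) : Set₁ where
  field
    iso-closed    : ∀ {A B} → A ≅ B → 𝒞 A → 𝒞 B
    right-summand : ∀ A B → 𝒞 (A +ᴸ B) → 𝒞 B
    ordinal-sums  : (β : LinOrd) → WellFounded (lt β) →
                    (F : Car β → LinOrd) → (∀ α → 𝒞 (F α)) → 𝒞 (OrdSum β F)

record SumOp : Set₁ where
  field
    op : LinOrd → LinOrd → LinOrd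
    ιˡ : ∀ A B → Car A → Car (op A B)
    ιʳ : ∀ A B → Car B → Car (op A B)

record IsSum (S : SumOp) : Set₁ where
  open SumOp S
  field
    ιˡ-emb   : ∀ A B → IsEmbedding A (op A B) (ιˡ A B)
    ιʳ-emb   : ∀ A B → IsEmbedding B (op A B) (ιʳ A B)
    disjoint : ∀ A B a b → ιˡ A B a ≢ ιʳ A B b
    cover    : ∀ A B z → (∃ λ a → ιˡ A B a ≡ z) ⊎ (∃ λ b → ιʳ A B b ≡ z)

IsRegular : SumOp → Set₁
IsRegular S = ∀ {A A' B B'} → A ≅ A' → B ≅ B' → op A B ≅ op A' B'
  where open SumOp S

IsAssociative : SumOp → Set₁
IsAssociative S = ∀ A B C → op A (op B C) ≅ op (op A B) C
  where open SumOp S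

record SumOpOn (𝒞 : LinOrd → Set) : Set₁ where
  field
    op     : (A B : LinOrd) → 𝒞 A → 𝒞 B → LinOrd
    closed : ∀ A B a b → 𝒞 (op A B a b)
    ιˡ     : ∀ A B a b → Car A → Car (op A B a b)
    ιʳ     : ∀ A B a b → Car B → Car (op A B a b)

record IsSumOn (𝒞 : LinOrd → Set) (S : SumOpOn 𝒞) : Set₁ where
  open SumOpOn S
  field
    ιˡ-emb   : ∀ A B a b → IsEmbedding A (op A B a b) (ιˡ A B a b)
    ιʳ-emb   : ∀ A B a b → IsEmbedding B (op A B a b) (ιʳ A B a b)
    disjoint : ∀ A B a b x y → ιˡ A B a b x ≢ ιʳ A B a b y
    cover    : ∀ A B a b z →
               (∃ λ x → ιˡ A B a b x ≡ z) ⊎ (∃ λ y → ιʳ A B a b y ≡ z)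

IsRegularOn : (𝒞 : LinOrd → Set) → SumOpOn 𝒞 → Set₁
IsRegularOn 𝒞 S = ∀ {A A' B B'} (a : 𝒞 A) (a' : 𝒞 A') (b : 𝒞 B) (b' : 𝒞 B') →
                  A ≅ A' → B ≅ B' → op A B a b ≅ op A' B' a' b'
  where open SumOpOn S

IsAssociativeOn : (𝒞 : LinOrd → Set) → SumOpOn 𝒞 → Set₁
IsAssociativeOn 𝒞 S = ∀ A B C (a : 𝒞 A) (b : 𝒞 B) (c : 𝒞 C) →
  op A (op B C b c) a (closed B C b c) ≅ op (op A B a b) C (closed A B a b) c
  where open SumOpOn S

-- A selector L picking, for every linear order A, its longest initial
-- segment belonging to 𝒞 (A_L = Sub A (L A), A_R = Sub A (not ∘ L A)).

record LongestInitial (𝒞 : LinOrd → Set) (L : (A : LinOrd) → Car A → Bool) : Set₁ where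
  field
    initial : ∀ A → IsInitial A (L A)
    inClass : ∀ A → 𝒞 (Sub A (L A))
    longest : ∀ A (S : Car A → Bool) → IsInitial A S → 𝒞 (Sub A S) →
              ∀ a → T (S a) → T (L A a)

_ᴸ[_] : LinOrd → ((A : LinOrd) → Car A → Bool) → LinOrd
A ᴸ[ L ] = Sub A (L A)

_ᴿ[_] : LinOrd → ((A : LinOrd) → Car A → Bool) → LinOrd
A ᴿ[ L ] = Sub A (λ a → not (L A a))

choose : (b : Bool) {X : Set} → (T b → X) → (T (not b) → X) → X
choose true  f g = f tt
choose false f g = g tt

inducedSum : (𝒞 : LinOrd → Set) → SumOpOn 𝒞 →
             (L : (A : LinOrd) → Car A → Bool) → LongestInitial 𝒞 L → SumOp
inducedSum 𝒞 S' L lg = record { op = op ; ιˡ = il ; ιʳ = ir }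
  where
  module S' = SumOpOn S'
  open LongestInitial lg
  core : LinOrd → LinOrd → LinOrd
  core A B = S'.op (A ᴸ[ L ]) (B ᴸ[ L ]) (inClass A) (inClass B)
  op : LinOrd → LinOrd → LinOrd
  op A B = core A B +ᴸ (A ᴿ[ L ]) +ᴸ (B ᴿ[ L ])
  il : ∀ A B → Car A → Car (op A B)
  il A B a = choose (L A a)
    (λ p → inj₁ (inj₁ (S'.ιˡ _ _ (inClass A) (inClass B) (a , p))))
    (λ q → inj₁ (inj₂ (a , q)))
  ir : ∀ A B → Car B → Car (op A B)
  ir A B b = choose (L B b)
    (λ p → inj₁ (inj₁ (S'.ιʳ _ _ (inClass A) (inClass B) (b , p))))
    (λ q → inj₂ (b , q))

{-# OPTIONS --safe #-}
module Submission where

-- A linear order A splits as A_L + A_R, and the right part A_R has empty longest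
-- 𝒞-initial segment (otherwise A_L could be prolonged).  Longest 𝒞-initial segments
-- are invariant under isomorphism, so ⊕ is regular, and for any X ∈ 𝒞 and Y, Z with
-- Y_L, Z_L empty the longest 𝒞-initial segment of (X + Y) + Z is exactly X.  Hence
-- (B ⊕ C)_L ≅ B_L ⊕' C_L and (B ⊕ C)_R ≅ B_R + C_R, which reduces associativity of ⊕
-- to that of ⊕' and of +.

open import Defs
open import Data.Bool using (Bool; true; false; T; not; if_then_else_; _<_; f<t)
open import Data.Bool.Properties using (T-irrelevant; <-wellFounded)
open import Data.Empty using (⊥-elim)
open import Data.Product using (_×_; _,_; proj₁; ∃)
open import Data.Sum using (_⊎_; inj₁; inj₂; [_,_]′; map; assocʳ; assocˡ)
open import Data.Sum.Properties using (inj₁-injective)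
open import Function using (id; _∘_)
open import Relation.Nullary using (¬_)
open import Relation.Binary.PropositionalEquality

open _≅_

T-not⇒¬T : ∀ {b} → T (not b) → ¬ T b
T-not⇒¬T {false} _ ()

T-ext : ∀ {b c} → (T b → T c) → (T c → T b) → b ≡ c
T-ext {true}  {true}  _ _ = refl
T-ext {true}  {false} f _ = ⊥-elim (f _)
T-ext {false} {true}  _ g = ⊥-elim (g _)
T-ext {false} {false} _ _ = refl

choose-natural : ∀ b {X Y : Set} (h : X → Y) {f : T b → X} {g : T (not b) → X} →
                 h (choose b f g) ≡ choose b (h ∘ f) (h ∘ g)
choose-natural true  h = refl
choose-natural false h = refl

choose-const : ∀ b {X : Set} (x : X) → choose b (λ _ → x) (λ _ → x) ≡ x
choose-const true  x = refl
choose-const false x = refl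

Empty : LinOrd → Set
Empty A = ¬ Car A

StrictlyMonotone : (A B : LinOrd) → (Car A → Car B) → Set
StrictlyMonotone A B f = ∀ {x y} → lt A x y → lt B (f x) (f y)

module _ {A B : LinOrd} {f : Car A → Car B} (f-mono : StrictlyMonotone A B f) where

  strictMono-reflects : ∀ {x y} → lt B (f x) (f y) → lt A x y
  strictMono-reflects {x} {y} r with lt-total A x y
  ... | inj₁ x<y         = x<y
  ... | inj₂ (inj₁ refl) = ⊥-elim (lt-irrefl B r)
  ... | inj₂ (inj₂ y<x)  = ⊥-elim (lt-irrefl B (lt-trans B r (f-mono y<x)))

  strictMono-injective : ∀ {x y} → f x ≡ f y → x ≡ y
  strictMono-injective {x} {y} e with lt-total A x y
  ... | inj₁ x<y         = ⊥-elim (lt-irrefl B (subst (lt B (f x)) (sym e) (f-mono x<y)))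
  ... | inj₂ (inj₁ x≡y)  = x≡y
  ... | inj₂ (inj₂ y<x)  = ⊥-elim (lt-irrefl B (subst (lt B (f y)) e (f-mono y<x)))

  strictMono⇒IsEmbedding : IsEmbedding A B f
  strictMono⇒IsEmbedding x y = f-mono , strictMono-reflects

map-strictMono : ∀ {A A' B B'} {f : Car A → Car A'} {g : Car B → Car B'} →
                 StrictlyMonotone A A' f → StrictlyMonotone B B' g →
                 StrictlyMonotone (A +ᴸ B) (A' +ᴸ B') (map f g)
map-strictMono f-mono g-mono (ll r) = ll (f-mono r)
map-strictMono f-mono g-mono lr     = lr
map-strictMono f-mono g-mono (rr r) = rr (g-mono r)

-- Linearity of A makes f injective and order-reflecting, so a right inverse suffices.
mk≅ : ∀ {A B} (f : Car A → Car B) (g : Car B → Car A) → (∀ b → f (g b) ≡ b) →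
      StrictlyMonotone A B f → A ≅ B
mk≅ {A} {B} f g f∘g f-mono = record
  { to = f ; from = g ; to∘from = f∘g ; to-mono = f-mono
  ; from∘to = λ a → strictMono-injective {A} {B} {f} f-mono (f∘g (f a))
  ; from-mono = λ {x} {y} r →
      strictMono-reflects {A} {B} {f} f-mono (subst₂ (lt B) (sym (f∘g x)) (sym (f∘g y)) r) }

≅-refl : ∀ {A} → A ≅ A
≅-refl = mk≅ id id (λ _ → refl) id

≅-sym : ∀ {A B} → A ≅ B → B ≅ A
≅-sym f = record { to = from f ; from = to f ; from∘to = to∘from f ; to∘from = from∘to f
                 ; to-mono = from-mono f ; from-mono = to-mono f }

≅-trans : ∀ {A B C} → A ≅ B → B ≅ C → A ≅ C
≅-trans f g = mk≅ (to g ∘ to f) (from f ∘ from g)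
  (λ c → trans (cong (to g) (to∘from f (from g c))) (to∘from g c))
  (to-mono g ∘ to-mono f)

+-cong : ∀ {A A' B B'} → A ≅ A' → B ≅ B' → (A +ᴸ B) ≅ (A' +ᴸ B')
+-cong f g = mk≅ (map (to f) (to g)) (map (from f) (from g)) to∘from′
  (map-strictMono (to-mono f) (to-mono g))
  where
  to∘from′ : ∀ z → map (to f) (to g) (map (from f) (from g) z) ≡ z
  to∘from′ (inj₁ a) = cong inj₁ (to∘from f a)
  to∘from′ (inj₂ b) = cong inj₂ (to∘from g b)

+-assoc : ∀ {A B C} → ((A +ᴸ B) +ᴸ C) ≅ (A +ᴸ (B +ᴸ C))
+-assoc {A} {B} {C} = mk≅ assocʳ assocˡ assocʳ∘assocˡ (λ {x} {y} → mono x y)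
  where
  assocʳ∘assocˡ : ∀ z → assocʳ (assocˡ z) ≡ z
  assocʳ∘assocˡ (inj₁ a)        = refl
  assocʳ∘assocˡ (inj₂ (inj₁ b)) = refl
  assocʳ∘assocˡ (inj₂ (inj₂ c)) = refl
  mono : ∀ x y → lt ((A +ᴸ B) +ᴸ C) x y → lt (A +ᴸ (B +ᴸ C)) (assocʳ x) (assocʳ y)
  mono (inj₁ (inj₁ _)) (inj₁ (inj₁ _)) (ll (ll r)) = ll r
  mono (inj₁ (inj₁ _)) (inj₁ (inj₂ _)) (ll lr)     = lr
  mono (inj₁ (inj₂ _)) (inj₁ (inj₂ _)) (ll (rr r)) = rr (ll r)
  mono (inj₁ (inj₁ _)) (inj₂ _)        lr          = lr
  mono (inj₁ (inj₂ _)) (inj₂ _)        lr          = rr lr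
  mono (inj₂ _)        (inj₂ _)        (rr r)      = rr (rr r)

+-identityʳ : ∀ {A B} → Empty B → (A +ᴸ B) ≅ A
+-identityʳ {A} {B} B-empty = mk≅ [ id , ⊥-elim ∘ B-empty ]′ inj₁ (λ _ → refl) mono
  where
  mono : StrictlyMonotone (A +ᴸ B) A [ id , ⊥-elim ∘ B-empty ]′
  mono (ll r)          = r
  mono (lr {y = b})    = ⊥-elim (B-empty b)
  mono (rr {x = b} _)  = ⊥-elim (B-empty b)

+-identityˡ : ∀ {A B} → Empty A → (A +ᴸ B) ≅ B
+-identityˡ {A} {B} A-empty = mk≅ [ ⊥-elim ∘ A-empty , id ]′ inj₂ (λ _ → refl) mono
  where
  mono : StrictlyMonotone (A +ᴸ B) B [ ⊥-elim ∘ A-empty , id ]′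
  mono (ll {x = a} _)  = ⊥-elim (A-empty a)
  mono (lr {x = a})    = ⊥-elim (A-empty a)
  mono (rr r)          = r

Two : LinOrd
Two = record { Car = Bool ; lt = _<_ ; lt-irrefl = λ () ; lt-trans = λ { f<t () }
             ; lt-total = total }
  where
  total : ∀ x y → x < y ⊎ x ≡ y ⊎ y < x
  total false false = inj₂ (inj₁ refl)
  total false true  = inj₁ f<t
  total true  false = inj₂ (inj₂ f<t)
  total true  true  = inj₂ (inj₁ refl)

OrdSum-Two≅+ : ∀ {A B} → OrdSum Two (λ b → if b then B else A) ≅ (A +ᴸ B)
OrdSum-Two≅+ {A} {B} = mk≅ to′ from′ to∘from′ mono
  where
  to′ : Car (OrdSum Two (λ b → if b then B else A)) → Car (A +ᴸ B)
  to′ (false , a) = inj₁ a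
  to′ (true  , b) = inj₂ b
  from′ : Car (A +ᴸ B) → Car (OrdSum Two (λ b → if b then B else A))
  from′ (inj₁ a) = false , a
  from′ (inj₂ b) = true , b
  to∘from′ : ∀ z → to′ (from′ z) ≡ z
  to∘from′ (inj₁ a) = refl
  to∘from′ (inj₂ b) = refl
  mono : StrictlyMonotone (OrdSum Two (λ b → if b then B else A)) (A +ᴸ B) to′
  mono (fst< f<t)       = lr
  mono (snd< {false} r) = ll r
  mono (snd< {true}  r) = rr r

Sub-≡ : ∀ {A S} {x y : Car (Sub A S)} → proj₁ x ≡ proj₁ y → x ≡ y
Sub-≡ {x = a , p} {y = .a , q} refl = cong (a ,_) (T-irrelevant p q)

Sub-cong : ∀ {A A' S S'} (f : A ≅ A') → (∀ a → S a ≡ S' (to f a)) → Sub A S ≅ Sub A' S'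
Sub-cong {A} {A'} {S} {S'} f S≡S'∘f = mk≅
  (λ (a , p) → to f a , subst T (S≡S'∘f a) p)
  (λ (a' , p') → from f a' ,
     subst T (sym (trans (S≡S'∘f (from f a')) (cong S' (to∘from f a')))) p')
  (λ _ → Sub-≡ {A'} {S'} (to∘from f _))
  (to-mono f)

Sub-true : ∀ {A} → Sub A (λ _ → true) ≅ A
Sub-true = mk≅ proj₁ (_, _) (λ _ → refl) id

Sub-+ : ∀ {A B} {S : Car (A +ᴸ B) → Bool} →
        Sub (A +ᴸ B) S ≅ (Sub A (S ∘ inj₁) +ᴸ Sub B (S ∘ inj₂))
Sub-+ {A} {B} {S} = mk≅ to′ [ (λ (a , p) → inj₁ a , p) , (λ (b , p) → inj₂ b , p) ]′
  to∘from′ (λ {x} {y} → mono x y)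
  where
  to′ : Car (Sub (A +ᴸ B) S) → Car (Sub A (S ∘ inj₁) +ᴸ Sub B (S ∘ inj₂))
  to′ (inj₁ a , p) = inj₁ (a , p)
  to′ (inj₂ b , p) = inj₂ (b , p)
  to∘from′ : ∀ z → to′ ([ (λ (a , p) → inj₁ a , p) , (λ (b , p) → inj₂ b , p) ]′ z) ≡ z
  to∘from′ (inj₁ _) = refl
  to∘from′ (inj₂ _) = refl
  mono : ∀ x y → lt (Sub (A +ᴸ B) S) x y →
         lt (Sub A (S ∘ inj₁) +ᴸ Sub B (S ∘ inj₂)) (to′ x) (to′ y)
  mono (inj₁ _ , _) (inj₁ _ , _) (ll r) = ll r
  mono (inj₁ _ , _) (inj₂ _ , _) lr     = lr
  mono (inj₂ _ , _) (inj₂ _ , _) (rr r) = rr r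

Sub-+-falseʳ : ∀ {A B} {S : Car A → Bool} → Sub (A +ᴸ B) [ S , (λ _ → false) ]′ ≅ Sub A S
Sub-+-falseʳ = ≅-trans Sub-+ (+-identityʳ (λ ()))

initial-precedes : ∀ {A S} → IsInitial A S → ∀ {x y} → T (S x) → T (not (S y)) → lt A x y
initial-precedes {A} {S} init {x} {y} p q with lt-total A x y
... | inj₁ x<y         = x<y
... | inj₂ (inj₁ refl) = ⊥-elim (T-not⇒¬T q p)
... | inj₂ (inj₂ y<x)  = ⊥-elim (T-not⇒¬T q (init y<x p))

segment+rest≅ : ∀ {A S} → IsInitial A S → (Sub A S +ᴸ Sub A (not ∘ S)) ≅ A
segment+rest≅ {A} {S} init = mk≅ [ proj₁ , proj₁ ]′ split merge∘split mono
  where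
  split : Car A → Car (Sub A S +ᴸ Sub A (not ∘ S))
  split a = choose (S a) (λ p → inj₁ (a , p)) (λ q → inj₂ (a , q))
  merge∘split : ∀ a → [ proj₁ , proj₁ ]′ (split a) ≡ a
  merge∘split a = trans (choose-natural (S a) [ proj₁ , proj₁ ]′) (choose-const (S a) a)
  mono : StrictlyMonotone (Sub A S +ᴸ Sub A (not ∘ S)) A [ proj₁ , proj₁ ]′
  mono (ll r)                        = r
  mono (lr {x = _ , p} {y = _ , q}) = initial-precedes {A} {S} init p q
  mono (rr r)                        = r

module LongestInitialProperties {𝒞 : LinOrd → Set} (lsg : LeftSumGenerating 𝒞)
  {L : (A : LinOrd) → Car A → Bool} (lg : LongestInitial 𝒞 L) where

  open LeftSumGenerating lsg
  open LongestInitial lg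

  +-closed : ∀ {A B} → 𝒞 A → 𝒞 B → 𝒞 (A +ᴸ B)
  +-closed {A} {B} a b = iso-closed OrdSum-Two≅+
    (ordinal-sums Two <-wellFounded (λ i → if i then B else A) λ { false → a ; true → b })

  L-of-𝒞 : ∀ {A} → 𝒞 A → ∀ a → T (L A a)
  L-of-𝒞 {A} c a = longest A (λ _ → true) (λ _ _ → _) (iso-closed (≅-sym Sub-true) c) a _

  ᴸ-of-𝒞 : ∀ {A} → 𝒞 A → (A ᴸ[ L ]) ≅ A
  ᴸ-of-𝒞 c = ≅-trans (Sub-cong ≅-refl (λ a → T-ext _ (λ _ → L-of-𝒞 c a))) Sub-true

  ᴿ-of-𝒞 : ∀ {A} → 𝒞 A → Empty (A ᴿ[ L ])
  ᴿ-of-𝒞 c (a , q) = T-not⇒¬T q (L-of-𝒞 c a)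

  L-≅⇒ : ∀ {A A'} (f : A ≅ A') → ∀ a → T (L A a) → T (L A' (to f a))
  L-≅⇒ {A} {A'} f a p = longest A' (L A ∘ from f) (initial A ∘ from-mono f)
    (iso-closed (≅-sym (Sub-cong (≅-sym f) (λ _ → refl))) (inClass A))
    (to f a) (subst (T ∘ L A) (sym (from∘to f a)) p)

  L-≅ : ∀ {A A'} (f : A ≅ A') → ∀ a → L A a ≡ L A' (to f a)
  L-≅ {A} f a = T-ext (L-≅⇒ f a)
    (λ q → subst (T ∘ L A) (from∘to f a) (L-≅⇒ (≅-sym f) (to f a) q))

  ᴸ+ᴿ≅ : ∀ A → ((A ᴸ[ L ]) +ᴸ (A ᴿ[ L ])) ≅ A
  ᴸ+ᴿ≅ A = segment+rest≅ (initial A)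

  ᴸ-cong : ∀ {A A'} → A ≅ A' → (A ᴸ[ L ]) ≅ (A' ᴸ[ L ])
  ᴸ-cong f = Sub-cong f (L-≅ f)

  ᴿ-cong : ∀ {A A'} → A ≅ A' → (A ᴿ[ L ]) ≅ (A' ᴿ[ L ])
  ᴿ-cong f = Sub-cong f (cong not ∘ L-≅ f)

  L-inj₁ : ∀ {A B a} → T (L A a) → T (L (A +ᴸ B) (inj₁ a))
  L-inj₁ {A} {B} {a} = longest (A +ᴸ B) [ L A , (λ _ → false) ]′ init
    (iso-closed (≅-sym Sub-+-falseʳ) (inClass A)) (inj₁ a)
    where
    init : IsInitial (A +ᴸ B) [ L A , (λ _ → false) ]′
    init (ll r) = initial A r
    init lr     ()
    init (rr _) ()

  L-inj₂⇒ : ∀ {A B b} → T (L (A +ᴸ B) (inj₂ b)) → T (L B b)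
  L-inj₂⇒ {A} {B} {b} = longest B (L (A +ᴸ B) ∘ inj₂) (initial (A +ᴸ B) ∘ rr)
    (right-summand _ _ (iso-closed Sub-+ (inClass (A +ᴸ B)))) b

  L-inj₂ : ∀ {A B b} → 𝒞 A → T (L B b) → T (L (A +ᴸ B) (inj₂ b))
  L-inj₂ {A} {B} {b} c = longest (A +ᴸ B) [ (λ _ → true) , L B ]′ init
    (iso-closed (≅-sym (≅-trans Sub-+ (+-cong Sub-true ≅-refl))) (+-closed c (inClass B)))
    (inj₂ b)
    where
    init : IsInitial (A +ᴸ B) [ (λ _ → true) , L B ]′
    init (ll _) _ = _
    init lr     _ = _
    init (rr r) p = initial B r p

  module _ {A B : LinOrd} (Bᴸ-empty : Empty (B ᴸ[ L ])) where

    L-inj₁⇒ : ∀ {a} → T (L (A +ᴸ B) (inj₁ a)) → T (L A a)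
    L-inj₁⇒ {a} = longest A (L (A +ᴸ B) ∘ inj₁) (initial (A +ᴸ B) ∘ ll)
      (iso-closed (≅-trans Sub-+ (+-identityʳ (λ (b , p) → Bᴸ-empty (b , L-inj₂⇒ p))))
                  (inClass (A +ᴸ B)))
      a

    L-+ : ∀ z → L (A +ᴸ B) z ≡ [ L A , (λ _ → false) ]′ z
    L-+ (inj₁ a) = T-ext L-inj₁⇒ L-inj₁
    L-+ (inj₂ b) = T-ext (λ p → Bᴸ-empty (b , L-inj₂⇒ p)) (λ ())

    ᴸ-+ : ((A +ᴸ B) ᴸ[ L ]) ≅ (A ᴸ[ L ])
    ᴸ-+ = ≅-trans (Sub-cong ≅-refl L-+) Sub-+-falseʳ

    ᴿ-+ : ((A +ᴸ B) ᴿ[ L ]) ≅ ((A ᴿ[ L ]) +ᴸ B)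
    ᴿ-+ = ≅-trans (Sub-cong ≅-refl (cong not ∘ L-+)) (≅-trans Sub-+ (+-cong ≅-refl Sub-true))

  ᴿ-ᴸ-empty : ∀ {A} → Empty ((A ᴿ[ L ]) ᴸ[ L ])
  ᴿ-ᴸ-empty {A} ((a , q) , p) = T-not⇒¬T q
    (subst T (L-≅ (ᴸ+ᴿ≅ A) (inj₂ (a , q))) (L-inj₂ (inClass A) p))

module InducedSumProperties {𝒞 : LinOrd → Set} (lsg : LeftSumGenerating 𝒞) (S' : SumOpOn 𝒞)
  {L : (A : LinOrd) → Car A → Bool} (lg : LongestInitial 𝒞 L) where

  open LongestInitialProperties lsg lg
  open LongestInitial lg
  module ⊕' = SumOpOn S'
  open SumOp (inducedSum 𝒞 S' L lg)

  core : LinOrd → LinOrd → LinOrd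
  core A B = ⊕'.op (A ᴸ[ L ]) (B ᴸ[ L ]) (inClass A) (inClass B)

  op-ᴸ : ∀ A B → (op A B ᴸ[ L ]) ≅ core A B
  op-ᴸ A B = ≅-trans (ᴸ-+ ᴿ-ᴸ-empty) (≅-trans (ᴸ-+ ᴿ-ᴸ-empty) (ᴸ-of-𝒞 (⊕'.closed _ _ _ _)))

  op-ᴿ : ∀ A B → (op A B ᴿ[ L ]) ≅ ((A ᴿ[ L ]) +ᴸ (B ᴿ[ L ]))
  op-ᴿ A B = ≅-trans (ᴿ-+ ᴿ-ᴸ-empty)
    (+-cong (≅-trans (ᴿ-+ ᴿ-ᴸ-empty) (+-identityˡ (ᴿ-of-𝒞 (⊕'.closed _ _ _ _)))) ≅-refl)

  regular : IsRegularOn 𝒞 S' → IsRegular (inducedSum 𝒞 S' L lg)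
  regular reg f g = +-cong (+-cong (reg _ _ _ _ (ᴸ-cong f) (ᴸ-cong g)) (ᴿ-cong f)) (ᴿ-cong g)

  associative : IsRegularOn 𝒞 S' → IsAssociativeOn 𝒞 S' → IsAssociative (inducedSum 𝒞 S' L lg)
  associative reg asc A B C =
    ≅-trans (+-cong (+-cong (reg _ _ _ _ ≅-refl (op-ᴸ B C)) ≅-refl) (op-ᴿ B C)) (
    ≅-trans (+-cong (+-cong (asc _ _ _ _ _ _) ≅-refl) ≅-refl) (
    ≅-trans (≅-sym +-assoc) (
    ≅-trans (+-cong +-assoc ≅-refl)
            (≅-sym (+-cong (+-cong (reg _ _ _ _ (op-ᴸ A B) ≅-refl) (op-ᴿ A B)) ≅-refl)))))

  module _ (isS : IsSumOn 𝒞 S') (A B : LinOrd) where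
    open IsSumOn isS

    jˡ : Car (A ᴸ[ L ]) → Car (core A B)
    jˡ = ⊕'.ιˡ (A ᴸ[ L ]) (B ᴸ[ L ]) (inClass A) (inClass B)

    jʳ : Car (B ᴸ[ L ]) → Car (core A B)
    jʳ = ⊕'.ιʳ (A ᴸ[ L ]) (B ᴸ[ L ]) (inClass A) (inClass B)

    hˡ : Car ((A ᴸ[ L ]) +ᴸ (A ᴿ[ L ])) → Car (op A B)
    hˡ = inj₁ ∘ map jˡ id

    hʳ : Car ((B ᴸ[ L ]) +ᴸ (B ᴿ[ L ])) → Car (op A B)
    hʳ = map (inj₁ ∘ jʳ) id

    hˡ-strictMono : StrictlyMonotone ((A ᴸ[ L ]) +ᴸ (A ᴿ[ L ])) (op A B) hˡ
    hˡ-strictMono r = ll (map-strictMono (λ {x} {y} → proj₁ (ιˡ-emb _ _ _ _ x y)) id r)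

    hʳ-strictMono : StrictlyMonotone ((B ᴸ[ L ]) +ᴸ (B ᴿ[ L ])) (op A B) hʳ
    hʳ-strictMono = map-strictMono (λ {x} {y} r → ll (proj₁ (ιʳ-emb _ _ _ _ x y) r)) id

    ιˡ-split : ∀ a → hˡ (from (ᴸ+ᴿ≅ A) a) ≡ ιˡ A B a
    ιˡ-split a = choose-natural (L A a) hˡ

    ιʳ-split : ∀ b → hʳ (from (ᴸ+ᴿ≅ B) b) ≡ ιʳ A B b
    ιʳ-split b = choose-natural (L B b) hʳ

    ιˡ-strictMono : StrictlyMonotone A (op A B) (ιˡ A B)
    ιˡ-strictMono {x} {y} r =
      subst₂ (lt (op A B)) (ιˡ-split x) (ιˡ-split y) (hˡ-strictMono (from-mono (ᴸ+ᴿ≅ A) r))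

    ιʳ-strictMono : StrictlyMonotone B (op A B) (ιʳ A B)
    ιʳ-strictMono {x} {y} r =
      subst₂ (lt (op A B)) (ιʳ-split x) (ιʳ-split y) (hʳ-strictMono (from-mono (ᴸ+ᴿ≅ B) r))

    hˡ≢hʳ : ∀ x y → hˡ x ≢ hʳ y
    hˡ≢hʳ (inj₁ x) (inj₁ y) e = disjoint _ _ _ _ x y (inj₁-injective (inj₁-injective e))
    hˡ≢hʳ (inj₁ _) (inj₂ _) ()
    hˡ≢hʳ (inj₂ _) (inj₁ _) ()
    hˡ≢hʳ (inj₂ _) (inj₂ _) ()

    hˡ-or-hʳ : ∀ z → (∃ λ x → hˡ x ≡ z) ⊎ (∃ λ y → hʳ y ≡ z)
    hˡ-or-hʳ (inj₁ (inj₁ k)) = map (λ (x , e) → inj₁ x , cong (inj₁ ∘ inj₁) e)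
                                   (λ (y , e) → inj₁ y , cong (inj₁ ∘ inj₁) e)
                                   (cover _ _ _ _ k)
    hˡ-or-hʳ (inj₁ (inj₂ r)) = inj₁ (inj₂ r , refl)
    hˡ-or-hʳ (inj₂ r)        = inj₂ (inj₂ r , refl)

    ιˡ≢ιʳ : ∀ a b → ιˡ A B a ≢ ιʳ A B b
    ιˡ≢ιʳ a b e = hˡ≢hʳ (from (ᴸ+ᴿ≅ A) a) (from (ᴸ+ᴿ≅ B) b)
      (trans (ιˡ-split a) (trans e (sym (ιʳ-split b))))

    ιˡ-or-ιʳ : ∀ z → (∃ λ a → ιˡ A B a ≡ z) ⊎ (∃ λ b → ιʳ A B b ≡ z)
    ιˡ-or-ιʳ z = map
      (λ (x , e) → to (ᴸ+ᴿ≅ A) x ,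
         trans (sym (ιˡ-split _)) (trans (cong hˡ (from∘to (ᴸ+ᴿ≅ A) x)) e))
      (λ (y , e) → to (ᴸ+ᴿ≅ B) y ,
         trans (sym (ιʳ-split _)) (trans (cong hʳ (from∘to (ᴸ+ᴿ≅ B) y)) e))
      (hˡ-or-hʳ z)

  isSum : IsSumOn 𝒞 S' → IsSum (inducedSum 𝒞 S' L lg)
  isSum isS = record
    { ιˡ-emb   = λ A B → strictMono⇒IsEmbedding {A} {op A B} (ιˡ-strictMono isS A B)
    ; ιʳ-emb   = λ A B → strictMono⇒IsEmbedding {B} {op A B} (ιʳ-strictMono isS A B)
    ; disjoint = ιˡ≢ιʳ isS
    ; cover    = ιˡ-or-ιʳ isS
    }

mainTheorem5 : (𝒞 : LinOrd → Set) → LeftSumGenerating 𝒞 →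
               (S' : SumOpOn 𝒞) → IsSumOn 𝒞 S' → IsRegularOn 𝒞 S' → IsAssociativeOn 𝒞 S' →
               (L : (A : LinOrd) → Car A → Bool) → (lg : LongestInitial 𝒞 L) →
               IsSum (inducedSum 𝒞 S' L lg) × IsRegular (inducedSum 𝒞 S' L lg)
                 × IsAssociative (inducedSum 𝒞 S' L lg)
mainTheorem5 𝒞 lsg S' isS reg asc L lg = isSum isS , regular reg , associative reg asc
  where open InducedSumProperties lsg S' lg
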